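{- Let $l\ge1$ and $C\ge1$ be integers and let $\phi^b_{(l,C)}=\neg B\wedge\bigwedge_{d=1}^{\lfloor l/(C+1)\rfloor}\phi^b_{(l,C,d)}\wedge\mathsf{frame}^b_{(l,C)}$ be the propositional formula defined below. Then $\phi^b_{(l,C)}$ is satisfiable if and only if there exists a sequence $x_1,\dots,x_l\in\{+1,-1\}$ of length $l$ with discrepancy at most $C$. Moreover, for every satisfying assignment of $\phi^b_{(l,C)}$, the sequence defined by $x_i=+1$ if $p_i$ is true and $x_i=-1$ if $p_i$ is false ($1\le i\le l$) has discrepancy at most $C$.
   Context: For a finite sequence $x_1,\dots,x_l\in\{+1,-1\}$, its discrepancy is $\max\{|\sum_{i=1}^{k}x_{id}| : d,k\ge1,\ kd\le l\}$. Let $D=\lfloor l/(C+1)\rfloor$ and $m=\lceil\log_2(C+1)\rceil$. Each integer $j$ with $-C\le j\le C$ is coded by a bit vector $(\beta_m,\beta_{m-1},\dots,\beta_0)$ where $\beta_m=1$ iff $j<0$ (sign bit) and $\beta_{m-1}\dots\beta_0$ is the binary representation of $|j|$. Propositional variables: $p_1,\dots,p_l$; $B$; and $b^{(i,d)}_0,\dots,b^{(i,d)}_m$ for $1\le d\le D$, $1\le i\le\lfloor l/d\rfloor+1$. For a bit vector $\beta$, let $[\beta]^{(i,d)}$ be the conjunction of the literals $b^{(i,d)}_t$ (if $\beta_t=1$) and $\neg b^{(i,d)}_t$ (if $\beta_t=0$), $0\le t\le m$; write $[j]^{(i,d)}$ for $[\beta]^{(i,d)}$ with $\beta$ the code of $j$.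 For $1\le d\le D$, $\phi^b_{(l,C,d)}$ is $[0]^{(1,d)}\wedge\bigwedge_{i=1}^{\lfloor l/d\rfloor}\Big[\bigwedge_{ -C\le j<C}([j]^{(i,d)}\wedge p_{id}\to [j+1]^{(i+1,d)})\wedge\bigwedge_{ -C<j\le C}([j]^{(i,d)}\wedge\neg p_{id}\to [j-1]^{(i+1,d)})\wedge([C]^{(i,d)}\wedge p_{id}\to B)\wedge([-C]^{(i,d)}\wedge\neg p_{id}\to B)\Big]$. $\mathsf{frame}^b_{(l,C)}$ is the conjunction, over all $1\le d\le D$, $1\le i\le\lfloor l/d\rfloor+1$ and all bit vectors $\beta\in\{0,1\}^{m+1}$ that are not the code of any $j\in\{ -C,\dots,C\}$ (e.g. sign bit $1$ with magnitude $0$, or magnitude exceeding $C$), of $\neg[\beta]^{(i,d)}$. -}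

module Defs where

open import Data.Bool using (Bool; true; false; not; _∧_; _∨_; if_then_else_)
open import Data.Nat using (ℕ; zero; suc; _+_; _*_; _∸_; _^_; _≤_; _/_; _%_; _⊔_; _≡ᵇ_)
open import Data.Nat.Logarithm using (⌈log₂_⌉)
open import Data.Integer as ℤ using (ℤ; +_; -[1+_]; ∣_∣)
open import Data.List using (List; []; _∷_; map; upTo; concatMap; foldr)
open import Data.Fin using (Fin; toℕ)
open import Data.Vec as Vec using (Vec; []; _∷_; lookup; tabulate)
open import Data.Vec.Relation.Unary.All using (All)
open import Data.Sum using (_⊎_)
open import Data.Product using (∃)
open import Relation.Binary.PropositionalEquality using (_≡_)

-- x_i (1-indexed) of a sequence of length l; 0 outside 1..l (never used
-- inside the range relevant for the discrepancy).
at : ∀ {l} → Vec ℤ l → ℕ → ℤ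
at {zero}  []       _             = + 0
at {suc l} (x ∷ xs) zero          = + 0
at {suc l} (x ∷ xs) (suc zero)    = x
at {suc l} (x ∷ xs) (suc (suc i)) = at xs (suc i)

IsPM : ∀ {l} → Vec ℤ l → Set
IsPM = All (λ z → z ≡ + 1 ⊎ z ≡ -[1+ 0 ])

-- ⌊n/d⌋ (only ever used with d ≥ 1; set to 0 for d = 0)
quot : ℕ → ℕ → ℕ
quot n zero    = 0
quot n (suc d) = n / suc d

range1 : ℕ → List ℕ
range1 n = map suc (upTo n)

sumℤ : List ℤ → ℤ
sumℤ = foldr ℤ._+_ (+ 0)

maxℕ : List ℕ → ℕ
maxℕ = foldr _⊔_ 0

partialSum : ∀ {l} → Vec ℤ l → ℕ → ℕ → ℤ
partialSum x d k = sumℤ (map (λ i → at x (i * d)) (range1 k))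

-- discrepancy = max { |Σ_{i≤k} x_{id}| : d,k ≥ 1, kd ≤ l }
-- (d ranges over 1..l and k over 1..⌊l/d⌋, which is exactly kd ≤ l)
discrepancy : ∀ {l} → Vec ℤ l → ℕ
discrepancy {l} x =
  maxℕ (concatMap (λ d → map (λ k → ∣ partialSum x d k ∣) (range1 (quot l d))) (range1 l))

data Var : Set where
  p : ℕ → Var
  B : Var
  b : ℕ → ℕ → ℕ → Var      -- b i d t  =  b^{(i,d)}_t

data Form : Set where
  var  : Var → Form
  ⊤f   : Form
  ¬f_  : Form → Form
  _∧f_ : Form → Form → Form
  _⇒f_ : Form → Form → Form

infixr 6 _∧f_
infixr 5 _⇒f_
infix 7 ¬f_

eval : (Var → Bool) → Form → Bool
eval σ (var v)  = σ v
eval σ ⊤f       = true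
eval σ (¬f φ)   = not (eval σ φ)
eval σ (φ ∧f ψ) = eval σ φ ∧ eval σ ψ
eval σ (φ ⇒f ψ) = not (eval σ φ) ∨ eval σ ψ

⋀ : List Form → Form
⋀ = foldr _∧f_ ⊤f

Satisfiable : Form → Set
Satisfiable φ = ∃ λ (σ : Var → Bool) → eval σ φ ≡ true

D : ℕ → ℕ → ℕ
D l C = l / suc C

mBits : ℕ → ℕ
mBits C = ⌈log₂ suc C ⌉

bit : ℕ → ℕ → Bool
bit zero    n = n % 2 ≡ᵇ 1
bit (suc t) n = bit t (n / 2)

isNeg : ℤ → Bool
isNeg (+ _)     = false
isNeg -[1+ _ ]  = true

-- code of j as bit vector β with lookup β t = β_t (0 ≤ t ≤ m):
-- β_m is the sign bit, β_{m-1}..β_0 the binary representation of |j|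
code : (m : ℕ) → ℤ → Vec Bool (suc m)
code m j = tabulate (λ t → if toℕ t ≡ᵇ m then isNeg j else bit (toℕ t) ∣ j ∣)

lit : Var → Bool → Form
lit v true  = var v
lit v false = ¬f var v

cube : ∀ {m} → ℕ → ℕ → Vec Bool (suc m) → Form
cube {m} i d β = ⋀ (Vec.toList (tabulate (λ t → lit (b i d (toℕ t)) (lookup β t))))

cubeℤ : ℕ → ℕ → ℕ → ℤ → Form
cubeℤ C i d j = cube {mBits C} i d (code (mBits C) j)

intsFrom : ℕ → ℕ → ℕ → List ℤ
intsFrom C a n = map (λ k → (+ (a + k)) ℤ.- (+ C)) (upTo n)

jsUp : ℕ → List ℤ
jsUp C = intsFrom C 0 (2 * C)

jsDown : ℕ → List ℤ
jsDown C = intsFrom C 1 (2 * C)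

jsAll : ℕ → List ℤ
jsAll C = intsFrom C 0 (suc (2 * C))

step : ℕ → ℕ → ℕ → Form
step C d i =
  ⋀ (map (λ j → (cubeℤ C i d j ∧f var (p (i * d))) ⇒f cubeℤ C (suc i) d (j ℤ.+ + 1)) (jsUp C))
  ∧f ⋀ (map (λ j → (cubeℤ C i d j ∧f ¬f var (p (i * d))) ⇒f cubeℤ C (suc i) d (j ℤ.- + 1)) (jsDown C))
  ∧f ((cubeℤ C i d (+ C) ∧f var (p (i * d))) ⇒f var B)
  ∧f ((cubeℤ C i d (ℤ.- (+ C)) ∧f ¬f var (p (i * d))) ⇒f var B)

phiD : ℕ → ℕ → ℕ → Form
phiD l C d = cubeℤ C 1 d (+ 0) ∧f ⋀ (map (step C d) (range1 (quot l d)))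

allBits : (n : ℕ) → List (Vec Bool n)
allBits zero    = [] ∷ []
allBits (suc n) = concatMap (λ v → (false ∷ v) ∷ (true ∷ v) ∷ []) (allBits n)

eqBits : ∀ {n} → Vec Bool n → Vec Bool n → Bool
eqBits []       []       = true
eqBits (x ∷ xs) (y ∷ ys) = (if x then y else not y) ∧ eqBits xs ys

anyB : ∀ {A : Set} → (A → Bool) → List A → Bool
anyB f = foldr (λ a r → f a ∨ r) false


isCodeOf : (C : ℕ) → Vec Bool (suc (mBits C)) → Bool
isCodeOf C β = anyB (λ j → eqBits β (code (mBits C) j)) (jsAll C)

frameCl : (C : ℕ) → ℕ → ℕ → Vec Bool (suc (mBits C)) → Form
frameCl C i d β = if isCodeOf C β then ⊤f else ¬f cube i d β

frame : ℕ → ℕ → Form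
frame l C =
  ⋀ (concatMap (λ d →
       concatMap (λ i → map (frameCl C i d) (allBits (suc (mBits C))))
                 (range1 (suc (quot l d))))
     (range1 (D l C)))

phi : ℕ → ℕ → Form
phi l C = ¬f var B ∧f ⋀ (map (phiD l C) (range1 (D l C))) ∧f frame l C

seqOf : (l : ℕ) → (Var → Bool) → Vec ℤ l
seqOf l σ = tabulate (λ i → if σ (p (suc (toℕ i))) then + 1 else -[1+ 0 ])

module Submission where

-- For each difference d ≤ D = ⌊l/(C+1)⌋ the formula runs a counter: the bits
-- b^{(i,d)} hold, in sign-magnitude binary, S(d,i-1) = x_d + … + x_{(i-1)d}; the
-- clauses at position i move it by ±1 as p_{id} says and force B as soon as it
-- would leave [-C, C].
-- Soundness: from [0]^{(1,d)}, induction on k (each step by stepSound) shows that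
-- a model with ¬B satisfies [S(d,k)]^{(k+1,d)} and |S(d,k)| ≤ C for d ≤ D; for
-- d > D the trivial bound |S(d,k)| ≤ k ≤ ⌊l/d⌋ ≤ C suffices.
-- Completeness: setting p_i iff x_i = +1 and b^{(i,d)} to the code of S(d,i-1)
-- satisfies every clause (stepComplete), because the code is injective.

open import Defs
open import Data.Bool using (Bool; true; false; not; _∧_; _∨_; if_then_else_)
open import Data.Nat as ℕ using (ℕ; zero; suc; _+_; _*_; _∸_; _^_; _≤_; _<_; z≤n; s≤s; s≤s⁻¹; z<s; s<s; _/_; _%_; _≡ᵇ_; ⌈_/2⌉; ⌊_/2⌋)
open import Data.Nat.Properties
open import Data.Nat.DivMod using (m≡m%n+[m/n]*n; m%n<n; m<n*o⇒m/o<n; m/n*n≤m; m<n⇒m/n≡0; m*n/n≡m; /-monoˡ-≤)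
open import Data.Nat.Logarithm.Core using (⌈log2⌉)
open import Induction.WellFounded using (Acc; acc)
open import Data.Integer as ℤ using (ℤ; +_; -[1+_]; ∣_∣; _⊖_)
import Data.Integer.Properties as ℤP
open import Data.Integer.Tactic.RingSolver using (solve-∀)
open import Data.List using ([]; _∷_; [_]; map; upTo; _∷ʳ_)
open import Data.List.Properties using (applyUpTo-∷ʳ; map-++)
open import Data.List.Relation.Unary.All using (All; []; _∷_; universal)
import Data.List.Relation.Unary.All.Properties as AllP
open import Data.List.Membership.Propositional using (_∈_)
open import Data.List.Membership.Propositional.Properties using (∈-map⁺; ∈-upTo⁺)
open import Data.List.Relation.Unary.Any using (here; there)
open import Data.Fin using (Fin; toℕ; fromℕ<) renaming (zero to fzero; suc to fsuc)
open import Data.Fin.Properties using (toℕ-fromℕ<)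
open import Data.Vec using (Vec; []; _∷_; lookup; tabulate; toList)
open import Data.Vec.Properties using (lookup∘tabulate; ∷-injective)
import Data.Vec.Relation.Unary.All as VecAll
open import Data.Vec.Relation.Unary.All.Properties using (tabulate⁺)
open import Data.Product using (_×_; _,_; ∃; proj₁; proj₂; uncurry)
open import Data.Product.Function.NonDependent.Propositional using (_×-⇔_)
open import Data.Sum using (_⊎_; inj₁; inj₂)
open import Data.Empty using (⊥; ⊥-elim)
open import Function using (_∘_; id)
open import Function.Bundles using (_⇔_; mk⇔; Equivalence)
import Function.Properties.Equivalence as ⇔
open import Relation.Nullary using (¬_; yes; no; contradiction)
open import Relation.Binary.PropositionalEquality hiding ([_])

open Equivalence using (to; from)

-- σ satisfies φ.  A record, so that φ can be inferred from a proof of Holds σ φ.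
record Holds (σ : Var → Bool) (φ : Form) : Set where
  constructor holds
  field evaluates-true : eval σ φ ≡ true
open Holds

∧≡true⇔ : ∀ a c → (a ∧ c ≡ true) ⇔ (a ≡ true × c ≡ true)
∧≡true⇔ true  c = mk⇔ (refl ,_) proj₂
∧≡true⇔ false c = mk⇔ (λ ()) (λ { (() , _) })

not≡true⇔ : ∀ a → (not a ≡ true) ⇔ (a ≡ false)
not≡true⇔ true  = mk⇔ (λ ()) (λ ())
not≡true⇔ false = mk⇔ (λ _ → refl) (λ _ → refl)

var⇔ : ∀ σ {v} → Holds σ (var v) ⇔ (σ v ≡ true)
var⇔ σ = mk⇔ evaluates-true holds

¬f⇔ : ∀ σ {φ} → Holds σ (¬f φ) ⇔ (eval σ φ ≡ false)
¬f⇔ σ {φ} = mk⇔ (to (not≡true⇔ (eval σ φ)) ∘ evaluates-true) (holds ∘ from (not≡true⇔ (eval σ φ)))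

∧f⇔ : ∀ σ {φ ψ} → Holds σ (φ ∧f ψ) ⇔ (Holds σ φ × Holds σ ψ)
∧f⇔ σ {φ} {ψ} = mk⇔
  (λ (holds h) → let (hφ , hψ) = to (∧≡true⇔ (eval σ φ) (eval σ ψ)) h in holds hφ , holds hψ)
  (λ (holds hφ , holds hψ) → holds (from (∧≡true⇔ (eval σ φ) (eval σ ψ)) (hφ , hψ)))

⇒f-elim : ∀ σ {φ ψ} → Holds σ (φ ⇒f ψ) → Holds σ φ → Holds σ ψ
⇒f-elim σ (holds h) (holds hφ) rewrite hφ = holds h

⇒f-intro : ∀ σ {φ ψ} → (Holds σ φ → Holds σ ψ) → Holds σ (φ ⇒f ψ)
⇒f-intro σ {φ} {ψ} f = holds (by-cases (eval σ φ) refl)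
  where
  by-cases : ∀ a → eval σ φ ≡ a → not a ∨ eval σ ψ ≡ true
  by-cases true  hφ = evaluates-true (f (holds hφ))
  by-cases false _  = refl

⋀⇔All : ∀ σ fs → Holds σ (⋀ fs) ⇔ All (Holds σ) fs
⋀⇔All σ []       = mk⇔ (λ _ → []) (λ _ → holds refl)
⋀⇔All σ (φ ∷ fs) = ⇔.trans (∧f⇔ σ) (mk⇔ (λ (h , hs) → h ∷ to (⋀⇔All σ fs) hs)
                                         (λ { (h ∷ hs) → h , from (⋀⇔All σ fs) hs }))

⋀-map⇔ : ∀ {A : Set} σ (f : A → Form) xs → Holds σ (⋀ (map f xs)) ⇔ All (Holds σ ∘ f) xs
⋀-map⇔ σ f xs = ⇔.trans (⋀⇔All σ (map f xs)) (mk⇔ AllP.map⁻ AllP.map⁺)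

All-upTo⇔ : ∀ {A : Set} {P : A → Set} (f : ℕ → A) n →
            All P (map f (upTo n)) ⇔ (∀ k → k < n → P (f k))
All-upTo⇔ f n = mk⇔ (λ h k k<n → AllP.applyUpTo⁻ id n (AllP.map⁻ h) k<n)
                    (λ h → AllP.map⁺ (AllP.applyUpTo⁺₁ id n (λ {k} → h k)))

lit⇔ : ∀ σ v c → Holds σ (lit v c) ⇔ (σ v ≡ c)
lit⇔ σ v true  = var⇔ σ
lit⇔ σ v false = ¬f⇔ σ

-- A conjunction of literals over the variables v t (the cube [β]^{(i,d)} is the
-- instance v t = b^{(i,d)}_t); it holds exactly when σ ∘ v agrees with β.
literals : ∀ {n} → (Fin n → Var) → Vec Bool n → Form
literals v β = ⋀ (toList (tabulate (λ t → lit (v t) (lookup β t))))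

literals⇔ : ∀ {n} σ (v : Fin n → Var) (β : Vec Bool n) →
            Holds σ (literals v β) ⇔ (tabulate (σ ∘ v) ≡ β)
literals⇔ σ v []      = mk⇔ (λ _ → refl) (λ _ → holds refl)
literals⇔ σ v (c ∷ β) =
  ⇔.trans (∧f⇔ σ)
    (⇔.trans (lit⇔ σ (v fzero) c ×-⇔ literals⇔ σ (v ∘ fsuc) β)
      (mk⇔ (uncurry (cong₂ _∷_)) ∷-injective))

bitsAt : ∀ m → (Var → Bool) → ℕ → ℕ → Vec Bool (suc m)
bitsAt m σ i d = tabulate (λ t → σ (b i d (toℕ t)))

cube⇔ : ∀ {m} σ i d (β : Vec Bool (suc m)) → Holds σ (cube i d β) ⇔ (bitsAt m σ i d ≡ β)
cube⇔ σ i d β = literals⇔ σ (λ t → b i d (toℕ t)) β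

n≤2^⌈log2⌉n : ∀ n (rec : Acc _<_ n) → n ≤ 2 ^ ⌈log2⌉ n rec
n≤2^⌈log2⌉n 0 _ = z≤n
n≤2^⌈log2⌉n 1 _ = s≤s z≤n
n≤2^⌈log2⌉n (suc (suc n)) (acc rs) = begin
  2 + n                                      ≤⟨ +-monoʳ-≤ 2 n≤2⌈n/2⌉ ⟩
  2 + 2 * ⌈ n /2⌉                            ≡⟨ *-suc 2 ⌈ n /2⌉ ⟨
  2 * suc ⌈ n /2⌉                            ≤⟨ *-monoʳ-≤ 2 (n≤2^⌈log2⌉n (suc ⌈ n /2⌉) (rs (⌈n/2⌉<n n))) ⟩
  2 * 2 ^ ⌈log2⌉ (suc ⌈ n /2⌉) (rs (⌈n/2⌉<n n))  ∎
  where
  open ≤-Reasoning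
  n≤2⌈n/2⌉ : n ≤ 2 * ⌈ n /2⌉
  n≤2⌈n/2⌉ = begin
    n                     ≡⟨ ⌊n/2⌋+⌈n/2⌉≡n n ⟨
    ⌊ n /2⌋ + ⌈ n /2⌉     ≤⟨ +-monoˡ-≤ ⌈ n /2⌉ (⌊n/2⌋≤⌈n/2⌉ n) ⟩
    ⌈ n /2⌉ + ⌈ n /2⌉     ≡⟨ cong (λ z → ⌈ n /2⌉ + z) (+-identityʳ ⌈ n /2⌉) ⟨
    2 * ⌈ n /2⌉           ∎

C<2^mBits : ∀ C → C < 2 ^ mBits C
C<2^mBits C = n≤2^⌈log2⌉n (suc C) _

digit-injective : ∀ {x y} → x < 2 → y < 2 → (x ≡ᵇ 1) ≡ (y ≡ᵇ 1) → x ≡ y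
digit-injective {0}           {0}           _ _ _  = refl
digit-injective {1}           {1}           _ _ _  = refl
digit-injective {0}           {1}           _ _ ()
digit-injective {1}           {0}           _ _ ()
digit-injective {suc (suc _)} (s≤s (s≤s ())) _ _
digit-injective {y = suc (suc _)} _ (s≤s (s≤s ())) _

bits-injective : ∀ m {a c} → a < 2 ^ m → c < 2 ^ m → (∀ t → t < m → bit t a ≡ bit t c) → a ≡ c
bits-injective zero    {zero}  {zero}  _       _ _ = refl
bits-injective zero    {suc _}         (s≤s ()) _ _
bits-injective zero    {c = suc _}     _ (s≤s ()) _
bits-injective (suc m) {a}     {c}     a<2^m c<2^m same = begin
  a                  ≡⟨ m≡m%n+[m/n]*n a 2 ⟩
  a % 2 + a / 2 * 2  ≡⟨ cong₂ (λ r q → r + q * 2) low high ⟩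
  c % 2 + c / 2 * 2  ≡⟨ m≡m%n+[m/n]*n c 2 ⟨
  c                  ∎
  where
  open ≡-Reasoning
  halve : ∀ {n} → n < 2 ^ suc m → n / 2 < 2 ^ m
  halve {n} n< = m<n*o⇒m/o<n (subst (n <_) (*-comm 2 (2 ^ m)) n<)
  low : a % 2 ≡ c % 2
  low = digit-injective (m%n<n a 2) (m%n<n c 2) (same 0 z<s)
  high : a / 2 ≡ c / 2
  high = bits-injective m (halve a<2^m) (halve c<2^m) (λ t t<m → same (suc t) (s<s t<m))

sign-magnitude-injective : ∀ {j j'} → isNeg j ≡ isNeg j' → ∣ j ∣ ≡ ∣ j' ∣ → j ≡ j'
sign-magnitude-injective {+ _}      {+ _}      _ e = cong +_ e
sign-magnitude-injective { -[1+ _ ]} { -[1+ _ ]} _ e = cong -[1+_] (suc-injective e)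
sign-magnitude-injective {+ _}      { -[1+ _ ]} () _
sign-magnitude-injective { -[1+ _ ]} {+ _}      () _

codeDigit : ℕ → ℤ → ℕ → Bool
codeDigit m j t = if t ≡ᵇ m then isNeg j else bit t ∣ j ∣

lookup-code : ∀ m j t (t≤m : t < suc m) → lookup (code m j) (fromℕ< t≤m) ≡ codeDigit m j t
lookup-code m j t t≤m =
  trans (lookup∘tabulate (codeDigit m j ∘ toℕ) (fromℕ< t≤m)) (cong (codeDigit m j) (toℕ-fromℕ< t≤m))

≡ᵇ-refl : ∀ n → (n ≡ᵇ n) ≡ true
≡ᵇ-refl zero    = refl
≡ᵇ-refl (suc n) = ≡ᵇ-refl n

<⇒≡ᵇ-false : ∀ {s n} → s < n → (s ≡ᵇ n) ≡ false
<⇒≡ᵇ-false {zero}  {suc _} _         = refl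
<⇒≡ᵇ-false {suc _} {suc _} (s≤s s<n) = <⇒≡ᵇ-false s<n

codeDigit-sign : ∀ m j → codeDigit m j m ≡ isNeg j
codeDigit-sign m j rewrite ≡ᵇ-refl m = refl

codeDigit-bit : ∀ m j {t} → t < m → codeDigit m j t ≡ bit t ∣ j ∣
codeDigit-bit m j t<m rewrite <⇒≡ᵇ-false t<m = refl

code-injective : ∀ m {j j'} → ∣ j ∣ < 2 ^ m → ∣ j' ∣ < 2 ^ m → code m j ≡ code m j' → j ≡ j'
code-injective m {j} {j'} j< j'< eq = sign-magnitude-injective sameSign sameMagnitude
  where
  digit : ∀ t → t < suc m → codeDigit m j t ≡ codeDigit m j' t
  digit t t≤m = trans (sym (lookup-code m j t t≤m))
                  (trans (cong (λ β → lookup β (fromℕ< t≤m)) eq) (lookup-code m j' t t≤m))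
  sameSign : isNeg j ≡ isNeg j'
  sameSign = trans (sym (codeDigit-sign m j)) (trans (digit m ≤-refl) (codeDigit-sign m j'))
  sameMagnitude : ∣ j ∣ ≡ ∣ j' ∣
  sameMagnitude = bits-injective m j< j'< λ t t<m →
    trans (sym (codeDigit-bit m j t<m)) (trans (digit t (m<n⇒m<1+n t<m)) (codeDigit-bit m j' t<m))

Encodes : (Var → Bool) → ℕ → ℕ → ℕ → ℤ → Set
Encodes σ C i d v = bitsAt (mBits C) σ i d ≡ code (mBits C) v

cubeℤ⇔ : ∀ σ C i d j → Holds σ (cubeℤ C i d j) ⇔ Encodes σ C i d j
cubeℤ⇔ σ C i d j = cube⇔ σ i d (code (mBits C) j)

encodes-unique : ∀ {σ C i d j j'} → Encodes σ C i d j → Encodes σ C i d j' →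
                 ∣ j ∣ ≤ C → ∣ j' ∣ ≤ C → j ≡ j'
encodes-unique {C = C} e e' j≤C j'≤C =
  code-injective (mBits C) (≤-<-trans j≤C (C<2^mBits C)) (≤-<-trans j'≤C (C<2^mBits C)) (trans (sym e) e')

-- Counter values in [-C, C] written as levels u - C with 0 ≤ u ≤ 2C; the index
-- lists jsUp, jsDown, jsAll of φ^b enumerate levels.
level : ℕ → ℕ → ℤ
level C u = + u ℤ.- + C

level-suc : ∀ C u → level C u ℤ.+ + 1 ≡ level C (suc u)
level-suc C u = lemma (+ u) (+ C)
  where
  lemma : ∀ a c → (a ℤ.- c) ℤ.+ + 1 ≡ (+ 1 ℤ.+ a) ℤ.- c
  lemma = solve-∀

level-pred : ∀ C u → level C (suc u) ℤ.- + 1 ≡ level C u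
level-pred C u = lemma (+ u) (+ C)
  where
  lemma : ∀ a c → ((+ 1 ℤ.+ a) ℤ.- c) ℤ.- + 1 ≡ a ℤ.- c
  lemma = solve-∀

level-bottom : ∀ C → level C 0 ≡ ℤ.- + C
level-bottom C = ℤP.+-identityˡ (ℤ.- + C)

level-top : ∀ C → level C (2 * C) ≡ + C
level-top C = lemma (+ C)
  where
  lemma : ∀ c → (c ℤ.+ (c ℤ.+ + 0)) ℤ.- c ≡ c
  lemma = solve-∀

C+C≡2*C : ∀ C → C + C ≡ 2 * C
C+C≡2*C C = cong (λ z → C + z) (sym (+-identityʳ C))

level-bounded : ∀ {C u} → u ≤ 2 * C → ∣ level C u ∣ ≤ C
level-bounded {C} {u} u≤2C rewrite ℤP.m-n≡m⊖n u C with ≤-total u C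
... | inj₁ u≤C = ≤-trans (≤-reflexive (ℤP.∣⊖∣-≤ u≤C)) (m∸n≤m C u)
... | inj₂ C≤u = begin
  ∣ u ⊖ C ∣  ≡⟨ ℤP.∣m⊖n∣≡∣n⊖m∣ u C ⟩
  ∣ C ⊖ u ∣  ≡⟨ ℤP.∣⊖∣-≤ C≤u ⟩
  u ∸ C      ≤⟨ m≤n+o⇒m∸n≤o u C (≤-trans u≤2C (≤-reflexive (sym (C+C≡2*C C)))) ⟩
  C          ∎
  where open ≤-Reasoning

level-onto : ∀ {C j} → ∣ j ∣ ≤ C → ∃ λ u → u ≤ 2 * C × level C u ≡ j
level-onto {C} {+ n} n≤C =
  n + C , ≤-trans (+-monoˡ-≤ C n≤C) (≤-reflexive (C+C≡2*C C)) , lemma (+ n) (+ C)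
  where
  lemma : ∀ a c → (a ℤ.+ c) ℤ.- c ≡ a
  lemma = solve-∀
level-onto {C} { -[1+ n ]} 1+n≤C = k , ≤-trans (m∸n≤m C (suc n)) (m≤m+n C (C + 0)) , k-C≡-[1+n]
  where
  k = C ∸ suc n
  lemma : ∀ a c → a ℤ.- (a ℤ.+ c) ≡ ℤ.- c
  lemma = solve-∀
  k-C≡-[1+n] : level C k ≡ -[1+ n ]
  k-C≡-[1+n] = begin
    + k ℤ.- + C             ≡⟨ cong (λ c → + k ℤ.- + c) (m∸n+n≡m 1+n≤C) ⟨
    + k ℤ.- + (k + suc n)   ≡⟨ lemma (+ k) (+ suc n) ⟩
    -[1+ n ]                ∎
    where open ≡-Reasoning

∣C+1∣≡1+C : ∀ C → ∣ + C ℤ.+ + 1 ∣ ≡ suc C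
∣C+1∣≡1+C C = +-comm C 1

∣-C-1∣≡1+C : ∀ C → ∣ ℤ.- (+ C) ℤ.- + 1 ∣ ≡ suc C
∣-C-1∣≡1+C C = begin
  ∣ ℤ.- (+ C) ℤ.- + 1 ∣   ≡⟨ cong ∣_∣ (ℤP.neg-distrib-+ (+ C) (+ 1)) ⟨
  ∣ ℤ.- (+ C ℤ.+ + 1) ∣   ≡⟨ ℤP.∣-i∣≡∣i∣ (+ C ℤ.+ + 1) ⟩
  C + 1                    ≡⟨ +-comm C 1 ⟩
  suc C                    ∎
  where open ≡-Reasoning

upClause downClause : ℕ → ℕ → ℕ → ℤ → Form
upClause   C d i j = (cubeℤ C i d j ∧f var (p (i * d))) ⇒f cubeℤ C (suc i) d (j ℤ.+ + 1)
downClause C d i j = (cubeℤ C i d j ∧f ¬f var (p (i * d))) ⇒f cubeℤ C (suc i) d (j ℤ.- + 1)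

overflowUp overflowDown : ℕ → ℕ → ℕ → Form
overflowUp   C d i = (cubeℤ C i d (+ C) ∧f var (p (i * d))) ⇒f var B
overflowDown C d i = (cubeℤ C i d (ℤ.- (+ C)) ∧f ¬f var (p (i * d))) ⇒f var B

record StepHolds (σ : Var → Bool) (C d i : ℕ) : Set where
  field
    up       : ∀ u → u < 2 * C → Holds σ (upClause C d i (level C u))
    down     : ∀ u → u < 2 * C → Holds σ (downClause C d i (level C (suc u)))
    overUp   : Holds σ (overflowUp C d i)
    overDown : Holds σ (overflowDown C d i)

⋀-levels⇔ : ∀ σ C a n (F : ℤ → Form) →
            Holds σ (⋀ (map F (intsFrom C a n))) ⇔ (∀ u → u < n → Holds σ (F (level C (a + u))))
⋀-levels⇔ σ C a n F = ⇔.trans (⋀-map⇔ σ F (intsFrom C a n)) (All-upTo⇔ (λ k → level C (a + k)) n)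

step⇔ : ∀ σ C d i → Holds σ (step C d i) ⇔ StepHolds σ C d i
step⇔ σ C d i =
  ⇔.trans (∧f⇔ σ)
    (⇔.trans (⋀-levels⇔ σ C 0 (2 * C) (upClause C d i)
               ×-⇔ ⇔.trans (∧f⇔ σ) (⋀-levels⇔ σ C 1 (2 * C) (downClause C d i) ×-⇔ ∧f⇔ σ))
      (mk⇔ (λ (u , dn , ou , od) → record { up = u ; down = dn ; overUp = ou ; overDown = od })
           (λ s → let open StepHolds s in up , down , overUp , overDown)))

phiD⇔ : ∀ σ l C d → Holds σ (phiD l C d) ⇔
        (Holds σ (cubeℤ C 1 d (+ 0)) × (∀ k → k < quot l d → Holds σ (step C d (suc k))))
phiD⇔ σ l C d =
  ⇔.trans (∧f⇔ σ)
    (⇔.refl ×-⇔ ⇔.trans (⋀-map⇔ σ (step C d) (range1 (quot l d))) (All-upTo⇔ suc (quot l d)))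

phi⇔ : ∀ σ l C → Holds σ (phi l C) ⇔
       (σ B ≡ false × (∀ d → d < D l C → Holds σ (phiD l C (suc d))) × Holds σ (frame l C))
phi⇔ σ l C =
  ⇔.trans (∧f⇔ σ)
    (¬f⇔ σ ×-⇔ ⇔.trans (∧f⇔ σ)
                 (⇔.trans (⋀-map⇔ σ (phiD l C) (range1 (D l C))) (All-upTo⇔ suc (D l C)) ×-⇔ ⇔.refl))

frame-intro : ∀ σ l C → (∀ d i → i ≤ quot l (suc d) → ∀ β → Holds σ (frameCl C (suc i) (suc d) β)) →
              Holds σ (frame l C)
frame-intro σ l C h =
  from (⋀⇔All σ _) (AllP.concat⁺ (AllP.map⁺ (from (All-upTo⇔ suc (D l C)) λ d _ →
    AllP.concat⁺ (AllP.map⁺ (from (All-upTo⇔ suc (suc (quot l (suc d)))) λ i i≤q →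
      AllP.map⁺ (universal (h d i (s≤s⁻¹ i≤q)) _))))))

sgn : Bool → ℤ
sgn c = if c then + 1 else -[1+ 0 ]

PlusMinusOne : ℤ → Set
PlusMinusOne z = z ≡ + 1 ⊎ z ≡ -[1+ 0 ]

isPlus : ℤ → Bool
isPlus (+ 1) = true
isPlus _     = false

sgn-pm : ∀ c → PlusMinusOne (sgn c)
sgn-pm true  = inj₁ refl
sgn-pm false = inj₂ refl

pm-sgn : ∀ {z} → PlusMinusOne z → sgn (isPlus z) ≡ z
pm-sgn (inj₁ refl) = refl
pm-sgn (inj₂ refl) = refl

pm-abs : ∀ {z} → PlusMinusOne z → ∣ z ∣ ≡ 1
pm-abs (inj₁ refl) = refl
pm-abs (inj₂ refl) = refl

at-tabulate : ∀ {l} (g : ℕ → ℤ) {n} → n < l → at (tabulate {n = l} (λ i → g (suc (toℕ i)))) (suc n) ≡ g (suc n)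
at-tabulate {suc l} g {zero}  _         = refl
at-tabulate {suc l} g {suc n} (s≤s n<l) = at-tabulate (g ∘ suc) n<l

at-seqOf : ∀ l σ {n} → 1 ≤ n → n ≤ l → at (seqOf l σ) n ≡ sgn (σ (p n))
at-seqOf l σ {suc n} _ n<l = at-tabulate (λ k → sgn (σ (p k))) n<l

seqOf-isPM : ∀ l σ → IsPM (seqOf l σ)
seqOf-isPM l σ = tabulate⁺ (λ i → sgn-pm (σ (p (suc (toℕ i)))))

-- Entries 1 … l of a ±1 sequence are ±1; outside that range `at` reads 0.
at-isPM : ∀ {l} (x : Vec ℤ l) → IsPM x → ∀ {n} → 1 ≤ n → n ≤ l → PlusMinusOne (at x n)
at-isPM (_ ∷ _)  (pm VecAll.∷ _)   {1}           _ _         = pm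
at-isPM (_ ∷ xs) (_ VecAll.∷ pms)  {suc (suc n)} _ (s≤s n<l) = at-isPM xs pms (s≤s z≤n) n<l

at-abs≤1 : ∀ {l} (x : Vec ℤ l) → IsPM x → ∀ n → ∣ at x n ∣ ≤ 1
at-abs≤1 []       _                 _             = z≤n
at-abs≤1 (_ ∷ _)  _                 zero          = z≤n
at-abs≤1 (_ ∷ _)  (pm VecAll.∷ _)   (suc zero)    = ≤-reflexive (pm-abs pm)
at-abs≤1 (_ ∷ xs) (_ VecAll.∷ pms)  (suc (suc n)) = at-abs≤1 xs pms (suc n)

k≤l/d⇒k*d≤l : ∀ l d {k} → k ≤ quot l (suc d) → k * suc d ≤ l
k≤l/d⇒k*d≤l l d k≤q = ≤-trans (*-monoˡ-≤ (suc d) k≤q) (m/n*n≤m l (suc d))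

sumℤ-∷ʳ : ∀ xs a → sumℤ (xs ∷ʳ a) ≡ sumℤ xs ℤ.+ a
sumℤ-∷ʳ []       a = ℤP.+-comm a (+ 0)
sumℤ-∷ʳ (x ∷ xs) a = trans (cong (λ s → x ℤ.+ s) (sumℤ-∷ʳ xs a)) (sym (ℤP.+-assoc x (sumℤ xs) a))

partialSum-suc : ∀ {l} (x : Vec ℤ l) d k → partialSum x d (suc k) ≡ partialSum x d k ℤ.+ at x (suc k * d)
partialSum-suc x d k = begin
  sumℤ (map g (map suc (upTo (suc k))))      ≡⟨ cong (sumℤ ∘ map g ∘ map suc) (applyUpTo-∷ʳ id k) ⟨
  sumℤ (map g (map suc (upTo k ∷ʳ k)))       ≡⟨ cong (sumℤ ∘ map g) (map-++ suc (upTo k) [ k ]) ⟩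
  sumℤ (map g (range1 k ∷ʳ suc k))           ≡⟨ cong sumℤ (map-++ g (range1 k) [ suc k ]) ⟩
  sumℤ (map g (range1 k) ∷ʳ g (suc k))       ≡⟨ sumℤ-∷ʳ (map g (range1 k)) (g (suc k)) ⟩
  partialSum x d k ℤ.+ g (suc k)             ∎
  where
  open ≡-Reasoning
  g : ℕ → ℤ
  g i = at x (i * d)

partialSum-bound : ∀ {l} (x : Vec ℤ l) → IsPM x → ∀ d k → ∣ partialSum x d k ∣ ≤ k
partialSum-bound x pm d zero    = z≤n
partialSum-bound x pm d (suc k) = begin
  ∣ partialSum x d (suc k) ∣                  ≡⟨ cong ∣_∣ (partialSum-suc x d k) ⟩
  ∣ partialSum x d k ℤ.+ at x (suc k * d) ∣   ≤⟨ ℤP.∣i+j∣≤∣i∣+∣j∣ (partialSum x d k) _ ⟩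
  ∣ partialSum x d k ∣ + ∣ at x (suc k * d) ∣ ≤⟨ +-mono-≤ (partialSum-bound x pm d k) (at-abs≤1 x pm _) ⟩
  k + 1                                       ≡⟨ +-comm k 1 ⟩
  suc k                                       ∎
  where open ≤-Reasoning

maxℕ≤⇔ : ∀ {C} ys → maxℕ ys ≤ C ⇔ All (_≤ C) ys
maxℕ≤⇔ []       = mk⇔ (λ _ → []) (λ _ → z≤n)
maxℕ≤⇔ (y ∷ ys) =
  mk⇔ (λ h → m⊔n≤o⇒m≤o y _ h ∷ to (maxℕ≤⇔ ys) (m⊔n≤o⇒n≤o y _ h))
      (λ { (h ∷ hs) → ⊔-lub h (from (maxℕ≤⇔ ys) hs) })

SumsBoundedBy : ∀ {l} → ℕ → Vec ℤ l → Set
SumsBoundedBy {l} C x = ∀ d k → k ≤ quot l (suc d) → ∣ partialSum x (suc d) k ∣ ≤ C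

discrepancy≤⇔ : ∀ {l} (x : Vec ℤ l) C → discrepancy x ≤ C ⇔ SumsBoundedBy C x
discrepancy≤⇔ {l} x C =
  ⇔.trans (maxℕ≤⇔ _)
    (⇔.trans (mk⇔ (AllP.map⁻ ∘ AllP.concat⁻) (AllP.concat⁺ ∘ AllP.map⁺))
      (⇔.trans (All-upTo⇔ suc l) (mk⇔ rows⇒bounded bounded⇒rows)))
  where
  Row : ℕ → Set
  Row d = All (_≤ C) (map (λ k → ∣ partialSum x (suc d) k ∣) (range1 (quot l (suc d))))
  row⇔ : ∀ d → Row d ⇔ (∀ k → k < quot l (suc d) → ∣ partialSum x (suc d) (suc k) ∣ ≤ C)
  row⇔ d = ⇔.trans (mk⇔ AllP.map⁻ AllP.map⁺) (All-upTo⇔ suc (quot l (suc d)))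
  rows⇒bounded : (∀ d → d < l → Row d) → SumsBoundedBy C x
  rows⇒bounded rows d zero    _   = z≤n
  rows⇒bounded rows d (suc k) k<q with d <? l
  ... | yes d<l = to (row⇔ d) (rows d d<l) k k<q
  ... | no  d≮l = contradiction (subst (suc k ≤_) (m<n⇒m/n≡0 (s≤s (≮⇒≥ d≮l))) k<q) λ ()
  bounded⇒rows : SumsBoundedBy C x → ∀ d → d < l → Row d
  bounded⇒rows bounded d _ = from (row⇔ d) λ k → bounded d (suc k)

-- For d > ⌊l/(C+1)⌋ we get ⌊l/d⌋ ≤ C: otherwise (C+1)d ≤ ⌊l/d⌋d ≤ l,
-- i.e. d ≤ ⌊l/(C+1)⌋.
quot-small : ∀ l C d → D l C < suc d → quot l (suc d) ≤ C
quot-small l C d D<d with quot l (suc d) ≤? C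
... | yes q≤C = q≤C
... | no  q≰C = contradiction D<d (≤⇒≯ d≤D)
  where
  open ≤-Reasoning
  d*[C+1]≤l : suc d * suc C ≤ l
  d*[C+1]≤l = begin
    suc d * suc C        ≡⟨ *-comm (suc d) (suc C) ⟩
    suc C * suc d        ≤⟨ *-monoˡ-≤ (suc d) (≰⇒> q≰C) ⟩
    l / suc d * suc d    ≤⟨ m/n*n≤m l (suc d) ⟩
    l                    ∎
  d≤D : suc d ≤ D l C
  d≤D = begin
    suc d                    ≡⟨ m*n/n≡m (suc d) (suc C) ⟨
    suc d * suc C / suc C    ≤⟨ /-monoˡ-≤ (suc C) d*[C+1]≤l ⟩
    l / suc C                ∎

stepSound : ∀ {σ C d i j} → σ B ≡ false → StepHolds σ C d i → ∣ j ∣ ≤ C → Holds σ (cubeℤ C i d j) →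
            let j' = j ℤ.+ sgn (σ (p (i * d))) in ∣ j' ∣ ≤ C × Holds σ (cubeℤ C (suc i) d j')
stepSound {σ} {C} {d} {i} {j} σB steps j≤C hc with level-onto {C} {j} j≤C
... | u , u≤2C , refl = byLevel u u≤2C _ refl hc
  where
  open StepHolds steps
  cubeᵢ : ℤ → Form
  cubeᵢ = cubeℤ C i d
  B-forbidden : ¬ Holds σ (var B)
  B-forbidden (holds σB≡true) = contradiction (trans (sym σB≡true) σB) λ ()
  byLevel : ∀ u → u ≤ 2 * C → ∀ c → σ (p (i * d)) ≡ c → Holds σ (cubeᵢ (level C u)) →
       ∣ level C u ℤ.+ sgn c ∣ ≤ C × Holds σ (cubeℤ C (suc i) d (level C u ℤ.+ sgn c))
  byLevel u u≤2C true hp hc with m≤n⇒m<n∨m≡n u≤2C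
  ... | inj₁ u<2C =
        subst (λ v → ∣ v ∣ ≤ C) (sym (level-suc C u)) (level-bounded u<2C)
      , ⇒f-elim σ (up u u<2C) (from (∧f⇔ σ) (hc , from (var⇔ σ) hp))
  ... | inj₂ refl = ⊥-elim (B-forbidden (⇒f-elim σ overUp
        (from (∧f⇔ σ) (subst (Holds σ ∘ cubeᵢ) (level-top C) hc , from (var⇔ σ) hp))))
  byLevel zero _ false hp hc = ⊥-elim (B-forbidden (⇒f-elim σ overDown
        (from (∧f⇔ σ) (subst (Holds σ ∘ cubeᵢ) (level-bottom C) hc , from (¬f⇔ σ) hp))))
  byLevel (suc u) u<2C false hp hc =
        subst (λ v → ∣ v ∣ ≤ C) (sym (level-pred C u)) (level-bounded (≤-trans (n≤1+n u) u<2C))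
      , ⇒f-elim σ (down u u<2C) (from (∧f⇔ σ) (hc , from (¬f⇔ σ) hp))

counterRun : ∀ {l C σ d} → σ B ≡ false → Holds σ (phiD l C (suc d)) → ∀ k → k ≤ quot l (suc d) →
             let S = partialSum (seqOf l σ) (suc d) k in ∣ S ∣ ≤ C × Holds σ (cubeℤ C (suc k) (suc d) S)
counterRun {l} {C} {σ} {d} σB hφ zero    _   = z≤n , proj₁ (to (phiD⇔ σ l C (suc d)) hφ)
counterRun {l} {C} {σ} {d} σB hφ (suc k) k<q with counterRun {l} {C} {σ} {d} σB hφ k (<⇒≤ k<q)
... | S≤C , hc = subst (λ S → ∣ S ∣ ≤ C × Holds σ (cubeℤ C (suc (suc k)) (suc d) S)) (sym next)
                   (stepSound {j = partialSum x (suc d) k} σB steps S≤C hc)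
  where
  x : Vec ℤ l
  x = seqOf l σ
  steps : StepHolds σ C (suc d) (suc k)
  steps = to (step⇔ σ C (suc d) (suc k)) (proj₂ (to (phiD⇔ σ l C (suc d)) hφ) k k<q)
  next : partialSum x (suc d) (suc k) ≡ partialSum x (suc d) k ℤ.+ sgn (σ (p (suc k * suc d)))
  next = trans (partialSum-suc x (suc d) k) (cong (λ v → partialSum x (suc d) k ℤ.+ v)
           (at-seqOf l σ (s≤s z≤n) (k≤l/d⇒k*d≤l l d k<q)))

soundness : ∀ l C σ → Holds σ (phi l C) → discrepancy (seqOf l σ) ≤ C
soundness l C σ h = from (discrepancy≤⇔ (seqOf l σ) C) bounded
  where
  σB : σ B ≡ false
  σB = proj₁ (to (phi⇔ σ l C) h)
  counters : ∀ d → d < D l C → Holds σ (phiD l C (suc d))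
  counters = proj₁ (proj₂ (to (phi⇔ σ l C) h))
  bounded : SumsBoundedBy C (seqOf l σ)
  bounded d k k≤q with suc d ≤? D l C
  ... | yes d<D = proj₁ (counterRun {l} {C} {σ} {d} σB (counters d d<D) k k≤q)
  ... | no  d≮D = ≤-trans (partialSum-bound (seqOf l σ) (seqOf-isPM l σ) (suc d) k)
                    (≤-trans k≤q (quot-small l C d (≰⇒> d≮D)))

eqBits-refl : ∀ {n} (β : Vec Bool n) → eqBits β β ≡ true
eqBits-refl []          = refl
eqBits-refl (true ∷ β)  = eqBits-refl β
eqBits-refl (false ∷ β) = eqBits-refl β

anyB-∈ : ∀ {A : Set} (f : A → Bool) {x xs} → x ∈ xs → f x ≡ true → anyB f xs ≡ true
anyB-∈ f (here refl) fx rewrite fx = refl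
anyB-∈ f {xs = y ∷ _} (there x∈xs) fx with f y
... | true  = refl
... | false = anyB-∈ f x∈xs fx

code-isCode : ∀ {C j} → ∣ j ∣ ≤ C → isCodeOf C (code (mBits C) j) ≡ true
code-isCode {C} {j} j≤C with level-onto {C} {j} j≤C
... | u , u≤2C , refl = anyB-∈ (λ k → eqBits (code (mBits C) (level C u)) (code (mBits C) k))
                          (∈-map⁺ (level C) (∈-upTo⁺ (s≤s u≤2C))) (eqBits-refl (code (mBits C) (level C u)))

frameCl-holds : ∀ {σ C i d v} → Encodes σ C i d v → ∣ v ∣ ≤ C → ∀ β → Holds σ (frameCl C i d β)
frameCl-holds {σ} {C} {i} {d} {v} enc v≤C β with isCodeOf C β in isCode
... | true  = holds refl
... | false = from (¬f⇔ σ) cube-fails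
  where
  cube-fails : eval σ (cube i d β) ≡ false
  cube-fails with eval σ (cube i d β) in hc
  ... | false = refl
  ... | true  = contradiction (trans (sym isCode) (subst (λ γ → isCodeOf C γ ≡ true) code≡β (code-isCode v≤C)))
                              λ ()
    where
    code≡β : code (mBits C) v ≡ β
    code≡β = trans (sym enc) (to (cube⇔ σ i d β) (holds hc))

stepComplete : ∀ {σ C d i v v'} → Encodes σ C i d v → Encodes σ C (suc i) d v' → ∣ v ∣ ≤ C → ∣ v' ∣ ≤ C →
               v' ≡ v ℤ.+ sgn (σ (p (i * d))) → StepHolds σ C d i
stepComplete {σ} {C} {d} {i} {v} {v'} enc enc' v≤C v'≤C next = record
  { up       = λ u u<2C → ⇒f-intro σ λ h → let (hc , hp) = to (∧f⇔ σ) h in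
                 moveTo (level-bounded (<⇒≤ u<2C)) hc (to (var⇔ σ) hp)
  ; down     = λ u u<2C → ⇒f-intro σ λ h → let (hc , hp) = to (∧f⇔ σ) h in
                 moveTo (level-bounded u<2C) hc (to (¬f⇔ σ) hp)
  ; overUp   = ⇒f-intro σ λ h → let (hc , hp) = to (∧f⇔ σ) h in
                 ⊥-elim (overflow ≤-refl hc (to (var⇔ σ) hp) (∣C+1∣≡1+C C))
  ; overDown = ⇒f-intro σ λ h → let (hc , hp) = to (∧f⇔ σ) h in
                 ⊥-elim (overflow (≤-reflexive (ℤP.∣-i∣≡∣i∣ (+ C))) hc (to (¬f⇔ σ) hp) (∣-C-1∣≡1+C C))
  }
  where
  -- a satisfied cube at i pins the value to v, so the next value is j ± 1
  successor : ∀ {j c} → ∣ j ∣ ≤ C → Holds σ (cubeℤ C i d j) → σ (p (i * d)) ≡ c → v' ≡ j ℤ.+ sgn c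
  successor {j} j≤C hc hp =
    trans next (cong₂ (λ w c → w ℤ.+ sgn c) v≡j hp)
    where
    v≡j : v ≡ j
    v≡j = encodes-unique {σ} {C} {i} {d} enc (to (cubeℤ⇔ σ C i d j) hc) v≤C j≤C
  moveTo : ∀ {j c} → ∣ j ∣ ≤ C → Holds σ (cubeℤ C i d j) → σ (p (i * d)) ≡ c →
           Holds σ (cubeℤ C (suc i) d (j ℤ.+ sgn c))
  moveTo {j} {c} j≤C hc hp =
    from (cubeℤ⇔ σ C (suc i) d (j ℤ.+ sgn c)) (subst (Encodes σ C (suc i) d) (successor j≤C hc hp) enc')
  overflow : ∀ {j c} → ∣ j ∣ ≤ C → Holds σ (cubeℤ C i d j) → σ (p (i * d)) ≡ c → ∣ j ℤ.+ sgn c ∣ ≡ suc C → ⊥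
  overflow j≤C hc hp ∣j±1∣≡1+C = 1+n≰n (subst (_≤ C) (trans (cong ∣_∣ (successor j≤C hc hp)) ∣j±1∣≡1+C) v'≤C)

module Completeness {l C : ℕ} (x : Vec ℤ l) (pm : IsPM x) (bounded : SumsBoundedBy C x) where

  model : Var → Bool
  model (p n)     = isPlus (at x n)
  model B         = false
  model (b i d t) = codeDigit (mBits C) (partialSum x d (ℕ.pred i)) t

  counterSteps : ∀ d k → k < quot l (suc d) → StepHolds model C (suc d) (suc k)
  counterSteps d k k<q =
    stepComplete {v = S k} {v' = S (suc k)} refl refl (bounded d k (<⇒≤ k<q)) (bounded d (suc k) k<q) next
    where
    S : ℕ → ℤ
    S = partialSum x (suc d)
    next : S (suc k) ≡ S k ℤ.+ sgn (model (p (suc k * suc d)))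
    next = trans (partialSum-suc x (suc d) k)
             (cong (λ z → S k ℤ.+ z) (sym (pm-sgn (at-isPM x pm (s≤s z≤n) (k≤l/d⇒k*d≤l l d k<q)))))

  -- S(d,0) = 0, so the counters start correctly; the frame holds as |S(d,i)| ≤ C
  satisfies : Holds model (phi l C)
  satisfies = from (phi⇔ model l C)
    ( refl
    , (λ d _ → from (phiD⇔ model l C (suc d))
                 ( from (cubeℤ⇔ model C 1 (suc d) (+ 0)) refl
                 , λ k k<q → from (step⇔ model C (suc d) (suc k)) (counterSteps d k k<q)))
    , frame-intro model l C (λ d i i≤q → frameCl-holds {v = partialSum x (suc d) i} refl (bounded d i i≤q)))

proposition2 : (l C : ℕ) → 1 ≤ l → 1 ≤ C →
    (Satisfiable (phi l C) ⇔ (∃ λ (x : Vec ℤ l) → IsPM x × discrepancy x ≤ C))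
    × ((σ : Var → Bool) → eval σ (phi l C) ≡ true → discrepancy (seqOf l σ) ≤ C)
proposition2 l C _ _ = mk⇔ readOff build , readOff-bounded
  where
  readOff-bounded : (σ : Var → Bool) → eval σ (phi l C) ≡ true → discrepancy (seqOf l σ) ≤ C
  readOff-bounded σ h = soundness l C σ (holds h)
  readOff : Satisfiable (phi l C) → ∃ λ (x : Vec ℤ l) → IsPM x × discrepancy x ≤ C
  readOff (σ , h) = seqOf l σ , seqOf-isPM l σ , readOff-bounded σ h
  build : (∃ λ (x : Vec ℤ l) → IsPM x × discrepancy x ≤ C) → Satisfiable (phi l C)
  build (x , pm , disc) = model , evaluates-true satisfies
    where open Completeness x pm (to (discrepancy≤⇔ x C) disc)
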